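{- Let $n\ge1$. For integers $0\le k\le n$ and $0\le i\le n$ put \[M_{n,k,i}=\sum_{a}(-1)^a\frac{n!\,(n-i+a)!\,(i+k-a)!}{a!\,(i-a)!\,(k-a)!\,(n-i-k+a)!},\] the sum over integers $a$ with $\max(0,i+k-n)\le a\le\min(i,k)$. Let $M'$ be the $n\times n$ rational matrix whose $(j,i)$ entry ($1\le j,i\le n$) is $M_{n,j,i-1}-M_{n,j,n}$. Then $M'$ is invertible. -}

module Defs where

open import Data.Nat as ℕ using (ℕ; zero; suc; _∸_; _!; _⊓_; _≤ᵇ_; NonZero)
open import Data.Nat.Properties using (_!≢0; m*n≢0)
open import Data.Integer as ℤ using (ℤ)
open import Data.Rational as ℚ using (ℚ; 0ℚ; 1ℚ)
open import Data.Fin using (Fin; toℕ) renaming (_≟_ to _≟ᶠ_)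
open import Relation.Nullary.Decidable using (⌊_⌋)
open import Data.Bool using (if_then_else_)
open import Relation.Binary.PropositionalEquality using (_≡_)
open import Data.Product using (∃; _×_)

sumℚ : ℕ → (ℕ → ℚ) → ℚ
sumℚ zero    f = 0ℚ
sumℚ (suc m) f = sumℚ m f ℚ.+ f m

sumFin : (n : ℕ) → (Fin n → ℚ) → ℚ
sumFin zero    f = 0ℚ
sumFin (suc n) f = f Fin.zero ℚ.+ sumFin n (λ x → f (Fin.suc x))
  where import Data.Fin as Fin

sgn : ℕ → ℚ
sgn zero    = 1ℚ
sgn (suc a) = ℚ.- sgn a

factFrac : ℕ → ℕ → ℕ → ℕ → ℕ → ℚ
factFrac x y₁ y₂ y₃ y₄ =
  ℚ._/_ (ℤ.+ x) (y₁ ! ℕ.* y₂ ! ℕ.* y₃ ! ℕ.* y₄ !)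
    {{m*n≢0 (y₁ ! ℕ.* y₂ ! ℕ.* y₃ !) (y₄ !)
       {{m*n≢0 (y₁ ! ℕ.* y₂ !) (y₃ !) {{m*n≢0 (y₁ !) (y₂ !) {{y₁ !≢0}} {{y₂ !≢0}}}} {{y₃ !≢0}}}}
       {{y₄ !≢0}}}}

-- summand for index a; for a in range, n-i-k+a = (n+a)∸(i+k)
term : ℕ → ℕ → ℕ → ℕ → ℚ
term n k i a =
  sgn a ℚ.* factFrac (n ! ℕ.* (n ∸ i ℕ.+ a) ! ℕ.* (i ℕ.+ k ∸ a) !)
                     a (i ∸ a) (k ∸ a) ((n ℕ.+ a) ∸ (i ℕ.+ k))

M : ℕ → ℕ → ℕ → ℚ
M n k i = sumℚ (suc (i ⊓ k)) (λ a → if (i ℕ.+ k) ≤ᵇ (n ℕ.+ a) then term n k i a else 0ℚ)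

Matrix : ℕ → Set
Matrix n = Fin n → Fin n → ℚ

-- M' : (j,i) entry (1 ≤ j,i ≤ n) is M_{n,j,i-1} - M_{n,j,n}; Fin index r stands for r+1
M′ : (n : ℕ) → Matrix n
M′ n j i = M n (suc (toℕ j)) (toℕ i) ℚ.- M n (suc (toℕ j)) n

_⊗_ : {n : ℕ} → Matrix n → Matrix n → Matrix n
_⊗_ {n} A B r c = sumFin n (λ t → A r t ℚ.* B t c)

identity : (n : ℕ) → Matrix n
identity n r c = if ⌊ r ≟ᶠ c ⌋ then 1ℚ else 0ℚ

Invertible : {n : ℕ} → Matrix n → Set
Invertible {n} A = ∃ λ (B : Matrix n) → (∀ r c → (A ⊗ B) r c ≡ identity n r c) × (∀ r c → (B ⊗ A) r c ≡ identity n r c)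

-- Dividing the summand of M n k i by n! k! leaves (-1)^a C(k,a) C(n-i+a,k) C(i+k-a,k), so M n k i = n! k! S₁.
-- Expanding C(i+k-a,k) by Vandermonde and evaluating Σ_a (-1)^a C(l,a) C(x+a,l+r) = (-1)^l C(x,r), an iterated
-- forward difference, turns S₁ into Σ_l (-1)^l C(i,l) C(k,l) C(n-i,k-l); the same two steps take
-- S₃ = Σ_{m ≤ k} (-1)^m C(k+m,m) C(n-m,k-m) C(i,m) there too. So as a function of i, M n k i is a combination of
-- C(i,0), …, C(i,k) with nonzero top coefficient n! k! (-1)^k C(2k,k), and M′ = L P R: row j of the lower
-- triangular L holds the coefficients of M n (j+1), and P R = (C(i,m+1) - C(n,m+1))_{m,i} is, by the hockey-stick
-- identity, the product of the triangular matrices P = (C(t,m))_{m,t} and R = (-[i ≤ t])_{t,i}.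
module Submission where

open import Data.Bool using (true; false; if_then_else_)
open import Data.Empty using (⊥-elim)
open import Data.Fin using (Fin; toℕ) renaming (zero to fzero; suc to fsuc; _≟_ to _≟ᶠ_)
import Data.Fin.Properties as Finₚ
import Data.Integer as ℤ
import Data.Integer.Properties as ℤₚ
open import Data.Nat as ℕ using (ℕ; zero; suc; _∸_; _≤_; _<_; _≥_; z≤n; s≤s; _!; _⊓_; _≤ᵇ_; NonZero)
open import Data.Nat.Combinatorics using (_C_; nCk≡n!/k![n-k]!; k![n∸k]!∣n!; k>n⇒nCk≡0; nCk≡nC[n∸k]; nCk+nC[k+1]≡[n+1]C[k+1])
import Data.Nat.Coprimality as Coprime
open import Data.Nat.DivMod using (m/n*n≡m)
import Data.Nat.Properties as ℕₚ
open ℕₚ using (_!≢0; _!*_!≢0)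
open import Data.Nat.Tactic.RingSolver using () renaming (solve-∀ to ℕ-solve)
open import Data.Product using (_,_; proj₁; proj₂)
open import Data.Rational as ℚ using (ℚ; 0ℚ; 1ℚ; mkℚ; _+_; _*_; -_; _-_; 1/_; _/_)
open import Data.Rational.Properties
import Data.Rational.Unnormalised as ℚᵘ
import Data.Rational.Unnormalised.Properties as ℚᵘₚ
open import Function using (_∘_)
open import Level using (0ℓ)
open import Relation.Binary.PropositionalEquality
open import Relation.Nullary using (¬_; yes; no)
open import Relation.Nullary.Decidable using (dec⇒maybe)
open import Tactic.RingSolver using (solve-∀)
import Tactic.RingSolver.Core.AlmostCommutativeRing as ACR

open import Defs

ℚ-ring : ACR.AlmostCommutativeRing 0ℓ 0ℓ
ℚ-ring = ACR.fromCommutativeRing +-*-commutativeRing (λ x → dec⇒maybe (0ℚ ≟ x))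

fromℕ : ℕ → ℚ
fromℕ n = mkℚ (ℤ.+ n) 0 (Coprime.sym (Coprime.1-coprimeTo n))

fromℕ-+ : ∀ m n → fromℕ (m ℕ.+ n) ≡ fromℕ m + fromℕ n
fromℕ-+ m n = toℚᵘ-injective (ℚᵘₚ.≃-trans (ℚᵘ.*≡* eq) (ℚᵘₚ.≃-sym (toℚᵘ-homo-+ (fromℕ m) (fromℕ n))))
  where
  eq : ℤ.+ (m ℕ.+ n) ℤ.* ℤ.+ 1 ≡ (ℤ.+ m ℤ.* ℤ.+ 1 ℤ.+ ℤ.+ n ℤ.* ℤ.+ 1) ℤ.* ℤ.+ 1
  eq = cong (ℤ._* ℤ.+ 1) (trans (ℤₚ.pos-+ m n) (sym (cong₂ ℤ._+_ (ℤₚ.*-identityʳ (ℤ.+ m)) (ℤₚ.*-identityʳ (ℤ.+ n)))))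

fromℕ-* : ∀ m n → fromℕ (m ℕ.* n) ≡ fromℕ m * fromℕ n
fromℕ-* m n = toℚᵘ-injective (ℚᵘₚ.≃-trans (ℚᵘ.*≡* eq) (ℚᵘₚ.≃-sym (toℚᵘ-homo-* (fromℕ m) (fromℕ n))))
  where
  eq : ℤ.+ (m ℕ.* n) ℤ.* ℤ.+ 1 ≡ (ℤ.+ m ℤ.* ℤ.+ n) ℤ.* ℤ.+ 1
  eq = cong (ℤ._* ℤ.+ 1) (ℤₚ.pos-* m n)

fromℕ-≢0 : ∀ n .{{_ : NonZero n}} → fromℕ n ≢ 0ℚ
fromℕ-≢0 (suc n) ()

[m*n]/n≡fromℕ-m : ∀ m n .{{_ : NonZero n}} → ℤ.+ (m ℕ.* n) / n ≡ fromℕ m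
[m*n]/n≡fromℕ-m m (suc n) = trans (fromℚᵘ-cong {ℚᵘ.mkℚᵘ (ℤ.+ (m ℕ.* suc n)) n} {ℚᵘ.mkℚᵘ (ℤ.+ m) 0} (ℚᵘ.*≡* eq)) (fromℚᵘ-toℚᵘ (fromℕ m))
  where
  eq : ℤ.+ (m ℕ.* suc n) ℤ.* ℤ.+ 1 ≡ ℤ.+ m ℤ.* ℤ.+ suc n
  eq = trans (ℤₚ.*-identityʳ _) (ℤₚ.pos-* m (suc n))

*-≢0 : ∀ {p q} → p ≢ 0ℚ → q ≢ 0ℚ → p * q ≢ 0ℚ
*-≢0 {p} {q} p≢0 q≢0 pq≡0 = p≢0 (begin
  p                ≡⟨ sym (*-identityʳ p) ⟩
  p * 1ℚ           ≡⟨ cong (p *_) (sym (*-inverseʳ q)) ⟩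
  p * (q * 1/ q)   ≡⟨ sym (*-assoc p q (1/ q)) ⟩
  (p * q) * 1/ q   ≡⟨ cong (_* 1/ q) pq≡0 ⟩
  0ℚ * 1/ q        ≡⟨ *-zeroˡ (1/ q) ⟩
  0ℚ               ∎)
  where
  open ≡-Reasoning
  instance _ = ℚ.≢-nonZero q≢0

sgn≢0 : ∀ a → sgn a ≢ 0ℚ
sgn≢0 zero    ()
sgn≢0 (suc a) eq = sgn≢0 a (neg-injective eq)

if-≤ᵇ-yes : ∀ {A : Set} {m n} {x y : A} → m ≤ n → (if m ≤ᵇ n then x else y) ≡ x
if-≤ᵇ-yes {m = m} {n} m≤n with m ≤ᵇ n | ℕₚ.≤⇒≤ᵇ m≤n
... | true | _ = refl

if-≤ᵇ-no : ∀ {A : Set} {m n} {x y : A} → ¬ m ≤ n → (if m ≤ᵇ n then x else y) ≡ y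
if-≤ᵇ-no {m = m} {n} m≰n with m ≤ᵇ n | ℕₚ.≤ᵇ⇒≤ m n
... | false | _     = refl
... | true  | ≤ᵇ⇒≤ = ⊥-elim (m≰n (≤ᵇ⇒≤ _))

sumℚ-cong< : ∀ m {f g : ℕ → ℚ} → (∀ a → a < m → f a ≡ g a) → sumℚ m f ≡ sumℚ m g
sumℚ-cong< zero    f≡g = refl
sumℚ-cong< (suc m) f≡g = cong₂ _+_ (sumℚ-cong< m (λ a a<m → f≡g a (ℕₚ.m<n⇒m<1+n a<m))) (f≡g m (ℕₚ.n<1+n m))

sumℚ-cong : ∀ m {f g : ℕ → ℚ} → f ≗ g → sumℚ m f ≡ sumℚ m g
sumℚ-cong m f≗g = sumℚ-cong< m (λ a _ → f≗g a)

sumℚ-0 : ∀ m {f : ℕ → ℚ} → (∀ a → a < m → f a ≡ 0ℚ) → sumℚ m f ≡ 0ℚ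
sumℚ-0 zero    f≡0 = refl
sumℚ-0 (suc m) f≡0 = trans (cong₂ _+_ (sumℚ-0 m (λ a a<m → f≡0 a (ℕₚ.m<n⇒m<1+n a<m))) (f≡0 m (ℕₚ.n<1+n m))) (+-identityʳ 0ℚ)

sumℚ-distrib-+ : ∀ m (f g : ℕ → ℚ) → sumℚ m (λ a → f a + g a) ≡ sumℚ m f + sumℚ m g
sumℚ-distrib-+ zero    f g = refl
sumℚ-distrib-+ (suc m) f g = trans (cong (_+ (f m + g m)) (sumℚ-distrib-+ m f g)) (interchange (sumℚ m f) (sumℚ m g) (f m) (g m))
  where
  interchange : ∀ a b c d → (a + b) + (c + d) ≡ (a + c) + (b + d)
  interchange = solve-∀ ℚ-ring

sumℚ-distribˡ : ∀ m c (f : ℕ → ℚ) → c * sumℚ m f ≡ sumℚ m (λ a → c * f a)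
sumℚ-distribˡ zero    c f = *-zeroʳ c
sumℚ-distribˡ (suc m) c f = trans (*-distribˡ-+ c (sumℚ m f) (f m)) (cong (_+ c * f m) (sumℚ-distribˡ m c f))

sumℚ-neg : ∀ m (f : ℕ → ℚ) → - sumℚ m f ≡ sumℚ m (λ a → - f a)
sumℚ-neg zero    f = refl
sumℚ-neg (suc m) f = trans (neg-distrib-+ (sumℚ m f) (f m)) (cong (_+ - f m) (sumℚ-neg m f))

sumℚ-comm : ∀ m p (f : ℕ → ℕ → ℚ) → sumℚ m (λ a → sumℚ p (f a)) ≡ sumℚ p (λ b → sumℚ m (λ a → f a b))
sumℚ-comm zero    p f = sym (sumℚ-0 p (λ _ _ → refl))
sumℚ-comm (suc m) p f = trans (cong (_+ sumℚ p (f m)) (sumℚ-comm m p f)) (sym (sumℚ-distrib-+ p _ (f m)))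

sumℚ-head : ∀ m (f : ℕ → ℚ) → sumℚ (suc m) f ≡ f 0 + sumℚ m (f ∘ suc)
sumℚ-head zero    f = trans (+-identityˡ (f 0)) (sym (+-identityʳ (f 0)))
sumℚ-head (suc m) f = trans (cong (_+ f (suc m)) (sumℚ-head m f)) (+-assoc (f 0) _ _)

sumℚ-split : ∀ m p (f : ℕ → ℚ) → sumℚ (m ℕ.+ p) f ≡ sumℚ m f + sumℚ p (λ b → f (m ℕ.+ b))
sumℚ-split m zero    f = trans (cong (λ x → sumℚ x f) (ℕₚ.+-identityʳ m)) (sym (+-identityʳ _))
sumℚ-split m (suc p) f = begin
  sumℚ (m ℕ.+ suc p) f                                        ≡⟨ cong (λ x → sumℚ x f) (ℕₚ.+-suc m p) ⟩
  sumℚ (m ℕ.+ p) f + f (m ℕ.+ p)                              ≡⟨ cong (_+ f (m ℕ.+ p)) (sumℚ-split m p f) ⟩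
  (sumℚ m f + sumℚ p (λ b → f (m ℕ.+ b))) + f (m ℕ.+ p)       ≡⟨ +-assoc (sumℚ m f) _ _ ⟩
  sumℚ m f + sumℚ (suc p) (λ b → f (m ℕ.+ b))                 ∎
  where open ≡-Reasoning

sumℚ-extend : ∀ {m m′} (f : ℕ → ℚ) → m ≤ m′ → (∀ a → m ≤ a → f a ≡ 0ℚ) → sumℚ m′ f ≡ sumℚ m f
sumℚ-extend {m} {m′} f m≤m′ f≡0 = begin
  sumℚ m′ f                                          ≡⟨ cong (λ x → sumℚ x f) (sym (ℕₚ.m+[n∸m]≡n m≤m′)) ⟩
  sumℚ (m ℕ.+ (m′ ∸ m)) f                            ≡⟨ sumℚ-split m (m′ ∸ m) f ⟩
  sumℚ m f + sumℚ (m′ ∸ m) (λ b → f (m ℕ.+ b))       ≡⟨ cong (sumℚ m f +_) (sumℚ-0 (m′ ∸ m) (λ b _ → f≡0 (m ℕ.+ b) (ℕₚ.m≤m+n m b))) ⟩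
  sumℚ m f + 0ℚ                                      ≡⟨ +-identityʳ _ ⟩
  sumℚ m f                                           ∎
  where open ≡-Reasoning

sumℚ-*-comm : ∀ m p (f : ℕ → ℚ) (g : ℕ → ℕ → ℚ) →
              sumℚ m (λ a → f a * sumℚ p (g a)) ≡ sumℚ p (λ b → sumℚ m (λ a → f a * g a b))
sumℚ-*-comm m p f g = trans (sumℚ-cong m (λ a → sumℚ-distribˡ p (f a) (g a))) (sumℚ-comm m p _)

sumℚ-offset : ∀ {m K} (g : ℕ → ℚ) → m ≤ K → (∀ b → b < m → g b ≡ 0ℚ) →
              sumℚ (suc (K ∸ m)) (λ j → g (m ℕ.+ j)) ≡ sumℚ (suc K) g
sumℚ-offset {m} {K} g m≤K g≡0 = begin
  sumℚ (suc (K ∸ m)) (λ j → g (m ℕ.+ j))                ≡⟨ sym (+-identityˡ _) ⟩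
  0ℚ + sumℚ (suc (K ∸ m)) (λ j → g (m ℕ.+ j))           ≡⟨ cong (_+ sumℚ (suc (K ∸ m)) (λ j → g (m ℕ.+ j))) (sym (sumℚ-0 m g≡0)) ⟩
  sumℚ m g + sumℚ (suc (K ∸ m)) (λ j → g (m ℕ.+ j))     ≡⟨ sym (sumℚ-split m (suc (K ∸ m)) g) ⟩
  sumℚ (m ℕ.+ suc (K ∸ m)) g                            ≡⟨ cong (λ x → sumℚ x g) (trans (ℕₚ.+-suc m (K ∸ m)) (cong suc (ℕₚ.m+[n∸m]≡n m≤K))) ⟩
  sumℚ (suc K) g                                        ∎
  where open ≡-Reasoning

nCk*k!*[n∸k]!≡n! : ∀ {n k} → k ≤ n → (n C k) ℕ.* (k ! ℕ.* (n ∸ k) !) ≡ n !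
nCk*k!*[n∸k]!≡n! {n} {k} k≤n = trans (cong (ℕ._* (k ! ℕ.* (n ∸ k) !)) (nCk≡n!/k![n-k]! k≤n)) (m/n*n≡m (k![n∸k]!∣n! k≤n))
  where instance _ = k !* (n ∸ k) !≢0

[m+n]Cm*m!*n!≡[m+n]! : ∀ m n → ((m ℕ.+ n) C m) ℕ.* (m ! ℕ.* n !) ≡ (m ℕ.+ n) !
[m+n]Cm*m!*n!≡[m+n]! m n =
  subst (λ x → ((m ℕ.+ n) C m) ℕ.* (m ! ℕ.* x !) ≡ (m ℕ.+ n) !) (ℕₚ.m+n∸m≡n m n) (nCk*k!*[n∸k]!≡n! (ℕₚ.m≤m+n m n))

[m+n]Cm≡[m+n]Cn : ∀ m n → (m ℕ.+ n) C m ≡ (m ℕ.+ n) C n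
[m+n]Cm≡[m+n]Cn m n = trans (nCk≡nC[n∸k] (ℕₚ.m≤m+n m n)) (cong ((m ℕ.+ n) C_) (ℕₚ.m+n∸m≡n m n))

-- Both sides count the ways to split an (a + b + d)-set into blocks of sizes a, b and d.
trinomial : ∀ a b d → let n = a ℕ.+ b ℕ.+ d in
            (n C a) ℕ.* ((n ∸ a) C b) ≡ (n C (a ℕ.+ b)) ℕ.* ((a ℕ.+ b) C a)
trinomial a b d = ℕₚ.*-cancelʳ-≡ _ _ (a ! ℕ.* b ! ℕ.* d !) {{ℕₚ.m*n≢0 _ _ {{a !* b !≢0}} {{d !≢0}}}}
  (trans (*-splitˡ (n C a) ((n ∸ a) C b) (a !) (b !) (d !) split-a split-b)
    (sym (*-splitʳ (n C (a ℕ.+ b)) ((a ℕ.+ b) C a) (a !) (b !) (d !) split-ab split-a+b)))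
  where
  n = a ℕ.+ b ℕ.+ d
  n∸a≡b+d : n ∸ a ≡ b ℕ.+ d
  n∸a≡b+d = trans (cong (_∸ a) (ℕₚ.+-assoc a b d)) (ℕₚ.m+n∸m≡n a (b ℕ.+ d))
  split-a : (n C a) ℕ.* (a ! ℕ.* (b ℕ.+ d) !) ≡ n !
  split-a = subst (λ m → (m C a) ℕ.* (a ! ℕ.* (b ℕ.+ d) !) ≡ m !) (sym (ℕₚ.+-assoc a b d)) ([m+n]Cm*m!*n!≡[m+n]! a (b ℕ.+ d))
  split-b : ((n ∸ a) C b) ℕ.* (b ! ℕ.* d !) ≡ (b ℕ.+ d) !
  split-b = subst (λ m → (m C b) ℕ.* (b ! ℕ.* d !) ≡ (b ℕ.+ d) !) (sym n∸a≡b+d) ([m+n]Cm*m!*n!≡[m+n]! b d)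
  split-ab : (n C (a ℕ.+ b)) ℕ.* ((a ℕ.+ b) ! ℕ.* d !) ≡ n !
  split-ab = [m+n]Cm*m!*n!≡[m+n]! (a ℕ.+ b) d
  split-a+b : ((a ℕ.+ b) C a) ℕ.* (a ! ℕ.* b !) ≡ (a ℕ.+ b) !
  split-a+b = [m+n]Cm*m!*n!≡[m+n]! a b
  *-splitˡ : ∀ x y u v w {Y N} → x ℕ.* (u ℕ.* Y) ≡ N → y ℕ.* (v ℕ.* w) ≡ Y → x ℕ.* y ℕ.* (u ℕ.* v ℕ.* w) ≡ N
  *-splitˡ x y u v w refl refl = lemma x y u v w
    where
    lemma : ∀ x y u v w → x ℕ.* y ℕ.* (u ℕ.* v ℕ.* w) ≡ x ℕ.* (u ℕ.* (y ℕ.* (v ℕ.* w)))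
    lemma = ℕ-solve
  *-splitʳ : ∀ x y u v w {Y N} → x ℕ.* (Y ℕ.* w) ≡ N → y ℕ.* (u ℕ.* v) ≡ Y → x ℕ.* y ℕ.* (u ℕ.* v ℕ.* w) ≡ N
  *-splitʳ x y u v w refl refl = lemma x y u v w
    where
    lemma : ∀ x y u v w → x ℕ.* y ℕ.* (u ℕ.* v ℕ.* w) ≡ x ℕ.* (y ℕ.* (u ℕ.* v) ℕ.* w)
    lemma = ℕ-solve

nCa*[n∸a]Cb≡nC[a+b]*[a+b]Ca : ∀ n a b → (n C a) ℕ.* ((n ∸ a) C b) ≡ (n C (a ℕ.+ b)) ℕ.* ((a ℕ.+ b) C a)
nCa*[n∸a]Cb≡nC[a+b]*[a+b]Ca n a b with a ℕ.+ b ℕₚ.≤? n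
... | yes a+b≤n = subst (λ m → (m C a) ℕ.* ((m ∸ a) C b) ≡ (m C (a ℕ.+ b)) ℕ.* ((a ℕ.+ b) C a))
                        (ℕₚ.m+[n∸m]≡n a+b≤n) (trinomial a b (n ∸ (a ℕ.+ b)))
... | no a+b≰n = trans lhs≡0 (sym (cong (ℕ._* ((a ℕ.+ b) C a)) (k>n⇒nCk≡0 n<a+b)))
  where
  n<a+b = ℕₚ.≰⇒> a+b≰n
  lhs≡0 : (n C a) ℕ.* ((n ∸ a) C b) ≡ 0
  lhs≡0 with a ℕₚ.≤? n
  ... | no a≰n = cong (ℕ._* ((n ∸ a) C b)) (k>n⇒nCk≡0 (ℕₚ.≰⇒> a≰n))
  ... | yes a≤n = trans (cong ((n C a) ℕ.*_) (k>n⇒nCk≡0 n∸a<b)) (ℕₚ.*-zeroʳ (n C a))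
    where
    n∸a<b : n ∸ a < b
    n∸a<b = ℕₚ.+-cancelˡ-< a _ _ (subst (_< a ℕ.+ b) (sym (ℕₚ.m+[n∸m]≡n a≤n)) n<a+b)

nCa*[n∸a]C[n∸l]≡nCl*lCa : ∀ {n l} a → l ≤ n → (n C a) ℕ.* ((n ∸ a) C (n ∸ l)) ≡ (n C l) ℕ.* (l C a)
nCa*[n∸a]C[n∸l]≡nCl*lCa {n} {l} a l≤n = begin
  (n C a) ℕ.* ((n ∸ a) C (n ∸ l))                  ≡⟨ nCa*[n∸a]Cb≡nC[a+b]*[a+b]Ca n a (n ∸ l) ⟩
  (n C (a ℕ.+ (n ∸ l))) ℕ.* ((a ℕ.+ (n ∸ l)) C a)  ≡⟨ cong₂ ℕ._*_ (cong (n C_) (ℕₚ.+-comm a _)) ([m+n]Cm≡[m+n]Cn a (n ∸ l)) ⟩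
  (n C ((n ∸ l) ℕ.+ a)) ℕ.* ((a ℕ.+ (n ∸ l)) C (n ∸ l)) ≡⟨ cong (λ m → (n C ((n ∸ l) ℕ.+ a)) ℕ.* (m C (n ∸ l))) (ℕₚ.+-comm a _) ⟩
  (n C ((n ∸ l) ℕ.+ a)) ℕ.* (((n ∸ l) ℕ.+ a) C (n ∸ l)) ≡⟨ sym (nCa*[n∸a]Cb≡nC[a+b]*[a+b]Ca n (n ∸ l) a) ⟩
  (n C (n ∸ l)) ℕ.* ((n ∸ (n ∸ l)) C a)            ≡⟨ cong₂ ℕ._*_ (sym (nCk≡nC[n∸k] l≤n)) (cong (_C a) (ℕₚ.m∸[m∸n]≡n l≤n)) ⟩
  (n C l) ℕ.* (l C a)                              ∎
  where open ≡-Reasoning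

binom : ℕ → ℕ → ℚ
binom n k = fromℕ (n C k)

binom-pascal : ∀ n k → binom (suc n) (suc k) ≡ binom n k + binom n (suc k)
binom-pascal n k = trans (cong fromℕ (sym (nCk+nC[k+1]≡[n+1]C[k+1] n k))) (fromℕ-+ (n C k) (n C suc k))

binom-0 : ∀ {n k} → n < k → binom n k ≡ 0ℚ
binom-0 n<k = cong fromℕ (k>n⇒nCk≡0 n<k)

fromℕ-*-cong : ∀ {a b c d} → a ℕ.* b ≡ c ℕ.* d → fromℕ a * fromℕ b ≡ fromℕ c * fromℕ d
fromℕ-*-cong {a} {b} {c} {d} eq = trans (sym (fromℕ-* a b)) (trans (cong fromℕ eq) (fromℕ-* c d))

vandermonde : ∀ x y r → binom (x ℕ.+ y) r ≡ sumℚ (suc r) (λ l → binom x l * binom y (r ∸ l))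
vandermonde zero    y r = sym (begin
  sumℚ (suc r) (λ l → binom 0 l * binom y (r ∸ l))          ≡⟨ sumℚ-head r _ ⟩
  1ℚ * binom y r + sumℚ r (λ l → 0ℚ * binom y (r ∸ suc l))  ≡⟨ cong₂ _+_ (*-identityˡ (binom y r)) (sumℚ-0 r (λ l _ → *-zeroˡ (binom y (r ∸ suc l)))) ⟩
  binom y r + 0ℚ                                            ≡⟨ +-identityʳ _ ⟩
  binom y r                                                 ∎)
  where open ≡-Reasoning
vandermonde (suc x) y zero    = refl
vandermonde (suc x) y (suc r) = begin
  binom (suc x ℕ.+ y) (suc r)                         ≡⟨ binom-pascal (x ℕ.+ y) r ⟩
  binom (x ℕ.+ y) r + binom (x ℕ.+ y) (suc r)         ≡⟨ cong₂ _+_ (vandermonde x y r) (trans (vandermonde x y (suc r)) (sumℚ-head (suc r) _)) ⟩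
  A + (binom x 0 * binom y (suc r) + B)               ≡⟨ rearrange A (binom x 0 * binom y (suc r)) B ⟩
  binom x 0 * binom y (suc r) + (A + B)               ≡⟨ cong (binom x 0 * binom y (suc r) +_) (sym (sumℚ-distrib-+ (suc r) _ _)) ⟩
  binom x 0 * binom y (suc r) + sumℚ (suc r) (λ l → binom x l * binom y (r ∸ l) + binom x (suc l) * binom y (r ∸ l))
    ≡⟨ cong (binom x 0 * binom y (suc r) +_) (sumℚ-cong (suc r) pascal-column) ⟩
  binom (suc x) 0 * binom y (suc r) + sumℚ (suc r) (λ l → binom (suc x) (suc l) * binom y (r ∸ l))
    ≡⟨ sym (sumℚ-head (suc r) _) ⟩
  sumℚ (suc (suc r)) (λ l → binom (suc x) l * binom y (suc r ∸ l)) ∎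
  where
  open ≡-Reasoning
  A = sumℚ (suc r) (λ l → binom x l * binom y (r ∸ l))
  B = sumℚ (suc r) (λ l → binom x (suc l) * binom y (r ∸ l))
  rearrange : ∀ a b c → a + (b + c) ≡ b + (a + c)
  rearrange = solve-∀ ℚ-ring
  pascal-column : ∀ l → binom x l * binom y (r ∸ l) + binom x (suc l) * binom y (r ∸ l) ≡ binom (suc x) (suc l) * binom y (r ∸ l)
  pascal-column l = trans (sym (*-distribʳ-+ (binom y (r ∸ l)) (binom x l) (binom x (suc l)))) (cong (_* binom y (r ∸ l)) (sym (binom-pascal x l)))

binom-≢0 : ∀ {n k} → k ≤ n → binom n k ≢ 0ℚ
binom-≢0 {n} {k} k≤n nCk≡0 = ℕ.≢-nonZero⁻¹ (n !) {{n !≢0}}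
  (trans (sym (nCk*k!*[n∸k]!≡n! k≤n)) (cong (ℕ._* (k ! ℕ.* (n ∸ k) !)) (ℤₚ.+-injective (cong ℚ.numerator nCk≡0))))

hockey-stick : ∀ {i N} m → i ≤ N → sumℚ N (λ t → if i ≤ᵇ t then binom t m else 0ℚ) ≡ binom N (suc m) - binom i (suc m)
hockey-stick {i} {zero}  m z≤n = refl
hockey-stick {i} {suc N} m i≤1+N with i ℕₚ.≤? N
... | yes i≤N = begin
  sumℚ N (λ t → if i ≤ᵇ t then binom t m else 0ℚ) + (if i ≤ᵇ N then binom N m else 0ℚ)
    ≡⟨ cong₂ _+_ (hockey-stick m i≤N) (if-≤ᵇ-yes i≤N) ⟩
  (binom N (suc m) - binom i (suc m)) + binom N m
    ≡⟨ rearrange (binom N (suc m)) (binom i (suc m)) (binom N m) ⟩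
  (binom N m + binom N (suc m)) - binom i (suc m)
    ≡⟨ cong (_- binom i (suc m)) (sym (binom-pascal N m)) ⟩
  binom (suc N) (suc m) - binom i (suc m) ∎
  where
  open ≡-Reasoning
  rearrange : ∀ x y z → (x - y) + z ≡ (z + x) - y
  rearrange = solve-∀ ℚ-ring
... | no i≰N rewrite ℕₚ.≤-antisym i≤1+N (ℕₚ.≰⇒> i≰N) =
  trans (cong₂ _+_ (sumℚ-0 N (λ t t<N → if-≤ᵇ-no {x = binom t m} (λ 1+N≤t → ℕₚ.<-irrefl refl (ℕₚ.<-≤-trans t<N (ℕₚ.≤-trans (ℕₚ.n≤1+n N) 1+N≤t)))))
                   (if-≤ᵇ-no {m = suc N} {N} {x = binom N m} (ℕₚ.<-irrefl refl)))
        (trans (+-identityʳ 0ℚ) (sym (+-inverseʳ (binom (suc N) (suc m)))))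

binom-trinomial : ∀ n a b → binom n a * binom (n ∸ a) b ≡ binom n (a ℕ.+ b) * binom (a ℕ.+ b) a
binom-trinomial n a b = fromℕ-*-cong {n C a} {(n ∸ a) C b} {n C (a ℕ.+ b)} {(a ℕ.+ b) C a} (nCa*[n∸a]Cb≡nC[a+b]*[a+b]Ca n a b)

binom-trinomial-swap : ∀ {n l} a → l ≤ n → binom n a * binom (n ∸ a) (n ∸ l) ≡ binom n l * binom l a
binom-trinomial-swap {n} {l} a l≤n = fromℕ-*-cong {n C a} {(n ∸ a) C (n ∸ l)} {n C l} {l C a} (nCa*[n∸a]C[n∸l]≡nCl*lCa a l≤n)

-- (-1)^l times the l-th forward difference of F at 0.
Δ : ℕ → (ℕ → ℚ) → ℚ
Δ l F = sumℚ (suc l) (λ a → sgn a * binom l a * F a)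

Δ-shift : ∀ l F → sumℚ (suc l) (λ a → sgn a * binom l (suc a) * F (suc a)) ≡ F 0 - Δ l F
Δ-shift l F = begin
  S + sgn l * binom l (suc l) * F (suc l)  ≡⟨ cong (λ z → S + sgn l * z * F (suc l)) (binom-0 (ℕₚ.n<1+n l)) ⟩
  S + sgn l * 0ℚ * F (suc l)               ≡⟨ rearrange S (sgn l) (F (suc l)) (F 0) ⟩
  F 0 - (1ℚ * 1ℚ * F 0 + - S)              ≡⟨ cong (λ z → F 0 - (1ℚ * 1ℚ * F 0 + z)) (sumℚ-neg l _) ⟩
  F 0 - (1ℚ * 1ℚ * F 0 + sumℚ l (λ a → - (sgn a * binom l (suc a) * F (suc a))))
    ≡⟨ cong (λ z → F 0 - (1ℚ * 1ℚ * F 0 + z)) (sumℚ-cong l (λ a → sym (-s*x*y≡-[s*x*y] (sgn a) _ _))) ⟩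
  F 0 - (1ℚ * 1ℚ * F 0 + sumℚ l (λ a → sgn (suc a) * binom l (suc a) * F (suc a)))
    ≡⟨ cong (λ z → F 0 - z) (sym (sumℚ-head l _)) ⟩
  F 0 - Δ l F                              ∎
  where
  open ≡-Reasoning
  S = sumℚ l (λ a → sgn a * binom l (suc a) * F (suc a))
  rearrange : ∀ t s g f → t + s * 0ℚ * g ≡ f - (1ℚ * 1ℚ * f + - t)
  rearrange = solve-∀ ℚ-ring
  -s*x*y≡-[s*x*y] : ∀ s x y → (- s) * x * y ≡ - (s * x * y)
  -s*x*y≡-[s*x*y] = solve-∀ ℚ-ring

Δ-suc : ∀ l F → Δ (suc l) F ≡ Δ l (λ a → F a - F (suc a))
Δ-suc l F = begin
  Δ (suc l) F
    ≡⟨ sumℚ-head (suc l) _ ⟩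
  1ℚ * 1ℚ * F 0 + sumℚ (suc l) (λ a → (- sgn a) * binom (suc l) (suc a) * F (suc a))
    ≡⟨ cong (1ℚ * 1ℚ * F 0 +_) (sumℚ-cong (suc l) pascal-split) ⟩
  1ℚ * 1ℚ * F 0 + sumℚ (suc l) (λ a → - (sgn a * binom l a * F (suc a)) + - (sgn a * binom l (suc a) * F (suc a)))
    ≡⟨ cong (1ℚ * 1ℚ * F 0 +_) (trans (sumℚ-distrib-+ (suc l) _ _) (cong₂ _+_ (sym (sumℚ-neg (suc l) _)) (sym (sumℚ-neg (suc l) _)))) ⟩
  1ℚ * 1ℚ * F 0 + (- Δ l (F ∘ suc) + - sumℚ (suc l) (λ a → sgn a * binom l (suc a) * F (suc a)))
    ≡⟨ cong (λ z → 1ℚ * 1ℚ * F 0 + (- Δ l (F ∘ suc) + - z)) (Δ-shift l F) ⟩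
  1ℚ * 1ℚ * F 0 + (- Δ l (F ∘ suc) + - (F 0 - Δ l F))
    ≡⟨ rearrange (F 0) (Δ l (F ∘ suc)) (Δ l F) ⟩
  Δ l F - Δ l (F ∘ suc)
    ≡⟨ cong (Δ l F +_) (sumℚ-neg (suc l) _) ⟩
  Δ l F + sumℚ (suc l) (λ a → - (sgn a * binom l a * F (suc a)))
    ≡⟨ sym (sumℚ-distrib-+ (suc l) _ _) ⟩
  sumℚ (suc l) (λ a → sgn a * binom l a * F a + - (sgn a * binom l a * F (suc a)))
    ≡⟨ sumℚ-cong (suc l) (λ a → factor (sgn a * binom l a) (F a) (F (suc a))) ⟩
  Δ l (λ a → F a - F (suc a)) ∎
  where
  open ≡-Reasoning
  rearrange : ∀ f x y → 1ℚ * 1ℚ * f + (- x + - (f - y)) ≡ y - x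
  rearrange = solve-∀ ℚ-ring
  factor : ∀ c x y → c * x + - (c * y) ≡ c * (x - y)
  factor = solve-∀ ℚ-ring
  distrib : ∀ s p q f → (- s) * (p + q) * f ≡ - (s * p * f) + - (s * q * f)
  distrib = solve-∀ ℚ-ring
  pascal-split : ∀ a → (- sgn a) * binom (suc l) (suc a) * F (suc a)
                       ≡ - (sgn a * binom l a * F (suc a)) + - (sgn a * binom l (suc a) * F (suc a))
  pascal-split a = trans (cong (λ z → (- sgn a) * z * F (suc a)) (binom-pascal l a)) (distrib (sgn a) _ _ (F (suc a)))

Δ-cong : ∀ l {F G : ℕ → ℚ} → F ≗ G → Δ l F ≡ Δ l G
Δ-cong l F≗G = sumℚ-cong (suc l) (λ a → cong (sgn a * binom l a *_) (F≗G a))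

Δ-neg : ∀ l F → Δ l (λ a → - F a) ≡ - Δ l F
Δ-neg l F = trans (sumℚ-cong (suc l) (λ a → x*-y≡-[x*y] (sgn a * binom l a) (F a))) (sym (sumℚ-neg (suc l) _))
  where
  x*-y≡-[x*y] : ∀ x y → x * (- y) ≡ - (x * y)
  x*-y≡-[x*y] = solve-∀ ℚ-ring

Δ-binom : ∀ l x r → Δ l (λ a → binom (x ℕ.+ a) (l ℕ.+ r)) ≡ sgn l * binom x r
Δ-binom zero    x r = trans (+-identityˡ _) (cong (λ m → 1ℚ * 1ℚ * binom m r) (ℕₚ.+-identityʳ x))
Δ-binom (suc l) x r = begin
  Δ (suc l) (λ a → binom (x ℕ.+ a) (suc l ℕ.+ r))  ≡⟨ Δ-suc l _ ⟩
  Δ l (λ a → binom (x ℕ.+ a) (suc (l ℕ.+ r)) - binom (x ℕ.+ suc a) (suc (l ℕ.+ r)))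
                                                   ≡⟨ Δ-cong l difference ⟩
  Δ l (λ a → - binom (x ℕ.+ a) (l ℕ.+ r))          ≡⟨ Δ-neg l _ ⟩
  - Δ l (λ a → binom (x ℕ.+ a) (l ℕ.+ r))          ≡⟨ cong -_ (Δ-binom l x r) ⟩
  - (sgn l * binom x r)                            ≡⟨ neg-distribˡ-* (sgn l) (binom x r) ⟩
  sgn (suc l) * binom x r                          ∎
  where
  open ≡-Reasoning
  y-[x+y]≡-x : ∀ x y → y - (x + y) ≡ - x
  y-[x+y]≡-x = solve-∀ ℚ-ring
  difference : ∀ a → binom (x ℕ.+ a) (suc (l ℕ.+ r)) - binom (x ℕ.+ suc a) (suc (l ℕ.+ r)) ≡ - binom (x ℕ.+ a) (l ℕ.+ r)
  difference a = begin
    binom (x ℕ.+ a) (suc (l ℕ.+ r)) - binom (x ℕ.+ suc a) (suc (l ℕ.+ r))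
      ≡⟨ cong (λ m → binom (x ℕ.+ a) (suc (l ℕ.+ r)) - binom m (suc (l ℕ.+ r))) (ℕₚ.+-suc x a) ⟩
    binom (x ℕ.+ a) (suc (l ℕ.+ r)) - binom (suc (x ℕ.+ a)) (suc (l ℕ.+ r))
      ≡⟨ cong (λ z → binom (x ℕ.+ a) (suc (l ℕ.+ r)) - z) (binom-pascal (x ℕ.+ a) (l ℕ.+ r)) ⟩
    binom (x ℕ.+ a) (suc (l ℕ.+ r)) - (binom (x ℕ.+ a) (l ℕ.+ r) + binom (x ℕ.+ a) (suc (l ℕ.+ r)))
      ≡⟨ y-[x+y]≡-x (binom (x ℕ.+ a) (l ℕ.+ r)) (binom (x ℕ.+ a) (suc (l ℕ.+ r))) ⟩
    - binom (x ℕ.+ a) (l ℕ.+ r) ∎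

Δ-extend : ∀ {l k} F → l ≤ k → sumℚ (suc k) (λ a → sgn a * binom l a * F a) ≡ Δ l F
Δ-extend F l≤k = sumℚ-extend _ (s≤s l≤k) (λ a l<a → trans (cong (λ z → sgn a * z * F a) (binom-0 l<a)) (x*0*y≡0 (sgn a) (F a)))
  where
  x*0*y≡0 : ∀ x y → x * 0ℚ * y ≡ 0ℚ
  x*0*y≡0 = solve-∀ ℚ-ring

alternating-binom-sum : ∀ {l k} s → l ≤ k → sumℚ (suc k) (λ a → sgn a * binom l a * binom (s ℕ.+ a) k) ≡ sgn l * binom s (k ∸ l)
alternating-binom-sum {l} {k} s l≤k = begin
  sumℚ (suc k) (λ a → sgn a * binom l a * binom (s ℕ.+ a) k)  ≡⟨ Δ-extend (λ a → binom (s ℕ.+ a) k) l≤k ⟩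
  Δ l (λ a → binom (s ℕ.+ a) k)                             ≡⟨ cong (λ m → Δ l (λ a → binom (s ℕ.+ a) m)) (sym (ℕₚ.m+[n∸m]≡n l≤k)) ⟩
  Δ l (λ a → binom (s ℕ.+ a) (l ℕ.+ (k ∸ l)))               ≡⟨ Δ-binom l s (k ∸ l) ⟩
  sgn l * binom s (k ∸ l)                                   ∎
  where open ≡-Reasoning

S₁-term : ℕ → ℕ → ℕ → ℕ → ℚ
S₁-term k i s a = sgn a * binom k a * binom (s ℕ.+ a) k * binom (i ℕ.+ (k ∸ a)) k

S₁ : ℕ → ℕ → ℕ → ℚ
S₁ k i s = sumℚ (suc k) (S₁-term k i s)

S₂ : ℕ → ℕ → ℕ → ℚ
S₂ k i s = sumℚ (suc k) (λ l → binom i l * (binom k l * (sgn l * binom s (k ∸ l))))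

alternating-trinomial-sum : ∀ {k l} s → l ≤ k →
  sumℚ (suc k) (λ a → sgn a * binom k a * binom (s ℕ.+ a) k * binom (k ∸ a) (k ∸ l)) ≡ binom k l * (sgn l * binom s (k ∸ l))
alternating-trinomial-sum {k} {l} s l≤k = begin
  sumℚ (suc k) (λ a → sgn a * binom k a * binom (s ℕ.+ a) k * binom (k ∸ a) (k ∸ l))
    ≡⟨ sumℚ-cong (suc k) swap ⟩
  sumℚ (suc k) (λ a → binom k l * (sgn a * binom l a * binom (s ℕ.+ a) k))
    ≡⟨ sym (sumℚ-distribˡ (suc k) (binom k l) _) ⟩
  binom k l * sumℚ (suc k) (λ a → sgn a * binom l a * binom (s ℕ.+ a) k)
    ≡⟨ cong (binom k l *_) (alternating-binom-sum s l≤k) ⟩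
  binom k l * (sgn l * binom s (k ∸ l)) ∎
  where
  open ≡-Reasoning
  regroup : ∀ g p r q → g * p * r * q ≡ (p * q) * (g * r)
  regroup = solve-∀ ℚ-ring
  ungroup : ∀ g p r q → (p * q) * (g * r) ≡ p * (g * q * r)
  ungroup = solve-∀ ℚ-ring
  swap : ∀ a → sgn a * binom k a * binom (s ℕ.+ a) k * binom (k ∸ a) (k ∸ l)
               ≡ binom k l * (sgn a * binom l a * binom (s ℕ.+ a) k)
  swap a = begin
    sgn a * binom k a * binom (s ℕ.+ a) k * binom (k ∸ a) (k ∸ l)
      ≡⟨ regroup (sgn a) (binom k a) (binom (s ℕ.+ a) k) (binom (k ∸ a) (k ∸ l)) ⟩
    (binom k a * binom (k ∸ a) (k ∸ l)) * (sgn a * binom (s ℕ.+ a) k)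
      ≡⟨ cong (_* (sgn a * binom (s ℕ.+ a) k)) (binom-trinomial-swap a l≤k) ⟩
    (binom k l * binom l a) * (sgn a * binom (s ℕ.+ a) k)
      ≡⟨ ungroup (sgn a) (binom k l) (binom (s ℕ.+ a) k) (binom l a) ⟩
    binom k l * (sgn a * binom l a * binom (s ℕ.+ a) k) ∎

S₁≡S₂ : ∀ k i s → S₁ k i s ≡ S₂ k i s
S₁≡S₂ k i s = begin
  S₁ k i s
    ≡⟨ sumℚ-cong (suc k) (λ a → cong (X a *_) (vandermonde i (k ∸ a) k)) ⟩
  sumℚ (suc k) (λ a → X a * sumℚ (suc k) (λ l → binom i l * binom (k ∸ a) (k ∸ l)))
    ≡⟨ sumℚ-*-comm (suc k) (suc k) X _ ⟩
  sumℚ (suc k) (λ l → sumℚ (suc k) (λ a → X a * (binom i l * binom (k ∸ a) (k ∸ l))))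
    ≡⟨ sumℚ-cong (suc k) (λ l → trans (sumℚ-cong (suc k) (λ a → x*[y*z]≡y*[x*z] (X a) (binom i l) (binom (k ∸ a) (k ∸ l))))
                                      (sym (sumℚ-distribˡ (suc k) (binom i l) _))) ⟩
  sumℚ (suc k) (λ l → binom i l * sumℚ (suc k) (λ a → X a * binom (k ∸ a) (k ∸ l)))
    ≡⟨ sumℚ-cong< (suc k) (λ l l<1+k → cong (binom i l *_) (alternating-trinomial-sum s (ℕₚ.≤-pred l<1+k))) ⟩
  S₂ k i s ∎
  where
  open ≡-Reasoning
  X : ℕ → ℚ
  X a = sgn a * binom k a * binom (s ℕ.+ a) k
  x*[y*z]≡y*[x*z] : ∀ x y z → x * (y * z) ≡ y * (x * z)
  x*[y*z]≡y*[x*z] = solve-∀ ℚ-ring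

-- Both sides count pairs A ⊆ B ⊆ [n] with |A| = m, |B| = k and A ⊆ [i], the right by b = |B ∩ [i]|.
binom-product-expansion : ∀ {n i k m} → i ≤ n → m ≤ k →
  binom i m * binom (n ∸ m) (k ∸ m) ≡ sumℚ (suc k) (λ b → binom b m * (binom i b * binom (n ∸ i) (k ∸ b)))
binom-product-expansion {n} {i} {k} {m} i≤n m≤k with m ℕₚ.≤? i
... | yes m≤i = begin
  binom i m * binom (n ∸ m) (k ∸ m)
    ≡⟨ cong (λ x → binom i m * binom x (k ∸ m)) n∸m≡[i∸m]+s ⟩
  binom i m * binom ((i ∸ m) ℕ.+ s) (k ∸ m)
    ≡⟨ cong (binom i m *_) (vandermonde (i ∸ m) s (k ∸ m)) ⟩
  binom i m * sumℚ (suc (k ∸ m)) (λ j → binom (i ∸ m) j * binom s (k ∸ m ∸ j))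
    ≡⟨ sumℚ-distribˡ (suc (k ∸ m)) (binom i m) _ ⟩
  sumℚ (suc (k ∸ m)) (λ j → binom i m * (binom (i ∸ m) j * binom s (k ∸ m ∸ j)))
    ≡⟨ sumℚ-cong (suc (k ∸ m)) reindex ⟩
  sumℚ (suc (k ∸ m)) (λ j → g (m ℕ.+ j))
    ≡⟨ sumℚ-offset g m≤k (λ b b<m → trans (cong (_* (binom i b * binom s (k ∸ b))) (binom-0 b<m)) (*-zeroˡ (binom i b * binom s (k ∸ b)))) ⟩
  sumℚ (suc k) g ∎
  where
  open ≡-Reasoning
  s = n ∸ i
  g : ℕ → ℚ
  g b = binom b m * (binom i b * binom s (k ∸ b))
  n∸m≡[i∸m]+s : n ∸ m ≡ (i ∸ m) ℕ.+ s
  n∸m≡[i∸m]+s = trans (cong (_∸ m) (sym (ℕₚ.m+[n∸m]≡n i≤n))) (ℕₚ.+-∸-comm s m≤i)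
  reindex : ∀ j → binom i m * (binom (i ∸ m) j * binom s (k ∸ m ∸ j)) ≡ g (m ℕ.+ j)
  reindex j = begin
    binom i m * (binom (i ∸ m) j * binom s (k ∸ m ∸ j))
      ≡⟨ sym (*-assoc (binom i m) (binom (i ∸ m) j) (binom s (k ∸ m ∸ j))) ⟩
    (binom i m * binom (i ∸ m) j) * binom s (k ∸ m ∸ j)
      ≡⟨ cong₂ _*_ (trans (binom-trinomial i m j) (*-comm (binom i (m ℕ.+ j)) (binom (m ℕ.+ j) m))) (cong (binom s) (ℕₚ.∸-+-assoc k m j)) ⟩
    (binom (m ℕ.+ j) m * binom i (m ℕ.+ j)) * binom s (k ∸ (m ℕ.+ j))
      ≡⟨ *-assoc (binom (m ℕ.+ j) m) (binom i (m ℕ.+ j)) (binom s (k ∸ (m ℕ.+ j))) ⟩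
    g (m ℕ.+ j) ∎
... | no m≰i = trans (cong (_* binom (n ∸ m) (k ∸ m)) (binom-0 i<m)) (trans (*-zeroˡ (binom (n ∸ m) (k ∸ m))) (sym (sumℚ-0 (suc k) vanishes)))
  where
  i<m = ℕₚ.≰⇒> m≰i
  vanishes : ∀ b → b < suc k → binom b m * (binom i b * binom (n ∸ i) (k ∸ b)) ≡ 0ℚ
  vanishes b _ with b ℕₚ.<? m
  ... | yes b<m = trans (cong (_* (binom i b * binom (n ∸ i) (k ∸ b))) (binom-0 b<m)) (*-zeroˡ (binom i b * binom (n ∸ i) (k ∸ b)))
  ... | no b≮m = trans (cong (λ z → binom b m * (z * binom (n ∸ i) (k ∸ b))) (binom-0 (ℕₚ.<-≤-trans i<m (ℕₚ.≮⇒≥ b≮m))))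
                       (trans (cong (binom b m *_) (*-zeroˡ (binom (n ∸ i) (k ∸ b)))) (*-zeroʳ (binom b m)))

basisCoeff : ℕ → ℕ → ℕ → ℚ
basisCoeff n k m = sgn m * binom (k ℕ.+ m) m * binom (n ∸ m) (k ∸ m)

S₃ : ℕ → ℕ → ℕ → ℚ
S₃ n k i = sumℚ (suc k) (λ m → basisCoeff n k m * binom i m)

S₃≡S₂ : ∀ {n i} k → i ≤ n → S₃ n k i ≡ S₂ k i (n ∸ i)
S₃≡S₂ {n} {i} k i≤n = begin
  S₃ n k i
    ≡⟨ sumℚ-cong< (suc k) expand ⟩
  sumℚ (suc k) (λ m → Y m * sumℚ (suc k) (λ b → binom b m * Q b))
    ≡⟨ sumℚ-*-comm (suc k) (suc k) Y _ ⟩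
  sumℚ (suc k) (λ b → sumℚ (suc k) (λ m → Y m * (binom b m * Q b)))
    ≡⟨ sumℚ-cong (suc k) (λ b → trans (sumℚ-cong (suc k) (regroup b)) (sym (sumℚ-distribˡ (suc k) (Q b) _))) ⟩
  sumℚ (suc k) (λ b → Q b * sumℚ (suc k) (λ m → sgn m * binom b m * binom (k ℕ.+ m) k))
    ≡⟨ sumℚ-cong< (suc k) (λ b b<1+k → evaluate b (ℕₚ.≤-pred b<1+k)) ⟩
  S₂ k i (n ∸ i) ∎
  where
  open ≡-Reasoning
  Y : ℕ → ℚ
  Y m = sgn m * binom (k ℕ.+ m) m
  Q : ℕ → ℚ
  Q b = binom i b * binom (n ∸ i) (k ∸ b)
  shuffle₁ : ∀ g a b c → g * a * b * c ≡ (g * a) * (c * b)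
  shuffle₁ = solve-∀ ℚ-ring
  shuffle₂ : ∀ g a b q → (g * a) * (b * q) ≡ q * (g * b * a)
  shuffle₂ = solve-∀ ℚ-ring
  shuffle₃ : ∀ x s g y → (x * s) * (g * y) ≡ x * (y * (g * s))
  shuffle₃ = solve-∀ ℚ-ring
  expand : ∀ m → m < suc k → basisCoeff n k m * binom i m ≡ Y m * sumℚ (suc k) (λ b → binom b m * Q b)
  expand m m<1+k = trans (shuffle₁ (sgn m) (binom (k ℕ.+ m) m) (binom (n ∸ m) (k ∸ m)) (binom i m))
                         (cong (Y m *_) (binom-product-expansion i≤n (ℕₚ.≤-pred m<1+k)))
  regroup : ∀ b m → Y m * (binom b m * Q b) ≡ Q b * (sgn m * binom b m * binom (k ℕ.+ m) k)
  regroup b m = trans (cong (λ x → (sgn m * fromℕ x) * (binom b m * Q b)) (sym ([m+n]Cm≡[m+n]Cn k m)))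
                      (shuffle₂ (sgn m) (binom (k ℕ.+ m) k) (binom b m) (Q b))
  evaluate : ∀ b → b ≤ k → Q b * sumℚ (suc k) (λ m → sgn m * binom b m * binom (k ℕ.+ m) k)
                           ≡ binom i b * (binom k b * (sgn b * binom (n ∸ i) (k ∸ b)))
  evaluate b b≤k = begin
    Q b * sumℚ (suc k) (λ m → sgn m * binom b m * binom (k ℕ.+ m) k) ≡⟨ cong (Q b *_) (alternating-binom-sum k b≤k) ⟩
    Q b * (sgn b * binom k (k ∸ b))                                  ≡⟨ cong (λ x → Q b * (sgn b * fromℕ x)) (sym (nCk≡nC[n∸k] b≤k)) ⟩
    Q b * (sgn b * binom k b)                                        ≡⟨ shuffle₃ (binom i b) (binom (n ∸ i) (k ∸ b)) (sgn b) (binom k b) ⟩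
    binom i b * (binom k b * (sgn b * binom (n ∸ i) (k ∸ b)))        ∎

factFrac-exact : ∀ {x} y₁ y₂ y₃ y₄ Q → x ≡ Q ℕ.* (y₁ ! ℕ.* y₂ ! ℕ.* y₃ ! ℕ.* y₄ !) → factFrac x y₁ y₂ y₃ y₄ ≡ fromℕ Q
factFrac-exact y₁ y₂ y₃ y₄ Q refl = [m*n]/n≡fromℕ-m Q (y₁ ! ℕ.* y₂ ! ℕ.* y₃ ! ℕ.* y₄ !)
  where instance _ = ℕₚ.m*n≢0 _ _ {{ℕₚ.m*n≢0 _ _ {{y₁ !* y₂ !≢0}} {{y₃ !≢0}}}} {{y₄ !≢0}}

private
  factorial-identity : ∀ N K X Y B₁ B₂ B₃ fa fp fq fr →
    B₁ ℕ.* (fa ℕ.* fq) ≡ K → B₂ ℕ.* (K ℕ.* fr) ≡ X → B₃ ℕ.* (K ℕ.* fp) ≡ Y →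
    N ℕ.* X ℕ.* Y ≡ (N ℕ.* K ℕ.* (B₁ ℕ.* B₂ ℕ.* B₃)) ℕ.* (fa ℕ.* fp ℕ.* fq ℕ.* fr)
  factorial-identity N _ _ _ B₁ B₂ B₃ fa fp fq fr refl refl refl = lemma N B₁ B₂ B₃ fa fp fq fr
    where
    lemma : ∀ N B₁ B₂ B₃ fa fp fq fr →
      N ℕ.* (B₂ ℕ.* (B₁ ℕ.* (fa ℕ.* fq) ℕ.* fr)) ℕ.* (B₃ ℕ.* (B₁ ℕ.* (fa ℕ.* fq) ℕ.* fp))
      ≡ (N ℕ.* (B₁ ℕ.* (fa ℕ.* fq)) ℕ.* (B₁ ℕ.* B₂ ℕ.* B₃)) ℕ.* (fa ℕ.* fp ℕ.* fq ℕ.* fr)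
    lemma = ℕ-solve

-- On the summation range n = a + p + q + r, k = a + q, i = a + p, so every truncated subtraction in term is exact.
module _ (a p q r : ℕ) where
  private
    n = a ℕ.+ p ℕ.+ q ℕ.+ r
    k = a ℕ.+ q
    i = a ℕ.+ p

    n∸i≡q+r : n ∸ i ≡ q ℕ.+ r
    n∸i≡q+r = trans (cong (_∸ i) (ℕₚ.+-assoc i q r)) (ℕₚ.m+n∸m≡n i (q ℕ.+ r))
    [i+k]∸a≡k+p : (i ℕ.+ k) ∸ a ≡ k ℕ.+ p
    [i+k]∸a≡k+p = trans (cong (_∸ a) (shuffle a p q)) (ℕₚ.m+n∸m≡n a (k ℕ.+ p))
      where
      shuffle : ∀ a p q → a ℕ.+ p ℕ.+ (a ℕ.+ q) ≡ a ℕ.+ (a ℕ.+ q ℕ.+ p)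
      shuffle = ℕ-solve
    [n+a]∸[i+k]≡r : (n ℕ.+ a) ∸ (i ℕ.+ k) ≡ r
    [n+a]∸[i+k]≡r = trans (cong (_∸ (i ℕ.+ k)) (shuffle a p q r)) (ℕₚ.m+n∸m≡n (i ℕ.+ k) r)
      where
      shuffle : ∀ a p q r → a ℕ.+ p ℕ.+ q ℕ.+ r ℕ.+ a ≡ a ℕ.+ p ℕ.+ (a ℕ.+ q) ℕ.+ r
      shuffle = ℕ-solve
    [n∸i]+a≡k+r : (n ∸ i) ℕ.+ a ≡ k ℕ.+ r
    [n∸i]+a≡k+r = trans (cong (ℕ._+ a) n∸i≡q+r) (shuffle a q r)
      where
      shuffle : ∀ a q r → q ℕ.+ r ℕ.+ a ≡ a ℕ.+ q ℕ.+ r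
      shuffle = ℕ-solve
    i+[k∸a]≡k+p : i ℕ.+ (k ∸ a) ≡ k ℕ.+ p
    i+[k∸a]≡k+p = trans (cong (i ℕ.+_) (ℕₚ.m+n∸m≡n a q)) (shuffle a p q)
      where
      shuffle : ∀ a p q → a ℕ.+ p ℕ.+ q ≡ a ℕ.+ q ℕ.+ p
      shuffle = ℕ-solve

    factorised : ℕ → ℕ → ℕ → ℕ → ℕ → ℕ
    factorised x y u v w = (n ! ℕ.* k ! ℕ.* ((k C a) ℕ.* (x C k) ℕ.* (y C k))) ℕ.* (a ! ℕ.* u ! ℕ.* v ! ℕ.* w !)

    term-numerator : n ! ℕ.* ((n ∸ i) ℕ.+ a) ! ℕ.* ((i ℕ.+ k) ∸ a) !
                     ≡ factorised ((n ∸ i) ℕ.+ a) (i ℕ.+ (k ∸ a)) (i ∸ a) (k ∸ a) ((n ℕ.+ a) ∸ (i ℕ.+ k))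
    term-numerator = begin
      n ! ℕ.* ((n ∸ i) ℕ.+ a) ! ℕ.* ((i ℕ.+ k) ∸ a) !
        ≡⟨ cong₂ (λ x y → n ! ℕ.* x ! ℕ.* y !) [n∸i]+a≡k+r [i+k]∸a≡k+p ⟩
      n ! ℕ.* (k ℕ.+ r) ! ℕ.* (k ℕ.+ p) !
        ≡⟨ factorial-identity (n !) (k !) ((k ℕ.+ r) !) ((k ℕ.+ p) !) (k C a) ((k ℕ.+ r) C k) ((k ℕ.+ p) C k) (a !) (p !) (q !) (r !)
             ([m+n]Cm*m!*n!≡[m+n]! a q) ([m+n]Cm*m!*n!≡[m+n]! k r) ([m+n]Cm*m!*n!≡[m+n]! k p) ⟩
      factorised (k ℕ.+ r) (k ℕ.+ p) p q r
        ≡⟨ sym (cong₂ (λ x y → factorised x y p q r) [n∸i]+a≡k+r i+[k∸a]≡k+p) ⟩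
      factorised ((n ∸ i) ℕ.+ a) (i ℕ.+ (k ∸ a)) p q r
        ≡⟨ sym (cong₂ (λ u v → factorised ((n ∸ i) ℕ.+ a) (i ℕ.+ (k ∸ a)) u v r) (ℕₚ.m+n∸m≡n a p) (ℕₚ.m+n∸m≡n a q)) ⟩
      factorised ((n ∸ i) ℕ.+ a) (i ℕ.+ (k ∸ a)) (i ∸ a) (k ∸ a) r
        ≡⟨ sym (cong (factorised ((n ∸ i) ℕ.+ a) (i ℕ.+ (k ∸ a)) (i ∸ a) (k ∸ a)) [n+a]∸[i+k]≡r) ⟩
      factorised ((n ∸ i) ℕ.+ a) (i ℕ.+ (k ∸ a)) (i ∸ a) (k ∸ a) ((n ℕ.+ a) ∸ (i ℕ.+ k)) ∎
      where open ≡-Reasoning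

  term-factorial-form : term n k i a ≡ fromℕ (n !) * fromℕ (k !) * S₁-term k i (n ∸ i) a
  term-factorial-form = begin
    sgn a * factFrac (n ! ℕ.* ((n ∸ i) ℕ.+ a) ! ℕ.* ((i ℕ.+ k) ∸ a) !) a (i ∸ a) (k ∸ a) ((n ℕ.+ a) ∸ (i ℕ.+ k))
      ≡⟨ cong (sgn a *_) (factFrac-exact a (i ∸ a) (k ∸ a) ((n ℕ.+ a) ∸ (i ℕ.+ k)) _ term-numerator) ⟩
    sgn a * fromℕ (n ! ℕ.* k ! ℕ.* (B₁ ℕ.* B₂ ℕ.* B₃))
      ≡⟨ cong (sgn a *_) (trans (fromℕ-* (n ! ℕ.* k !) _) (cong₂ _*_ (fromℕ-* (n !) (k !)) (trans (fromℕ-* (B₁ ℕ.* B₂) B₃) (cong (_* fromℕ B₃) (fromℕ-* B₁ B₂))))) ⟩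
    sgn a * (fromℕ (n !) * fromℕ (k !) * (fromℕ B₁ * fromℕ B₂ * fromℕ B₃))
      ≡⟨ shuffle (sgn a) (fromℕ (n !)) (fromℕ (k !)) (fromℕ B₁) (fromℕ B₂) (fromℕ B₃) ⟩
    fromℕ (n !) * fromℕ (k !) * (sgn a * fromℕ B₁ * fromℕ B₂ * fromℕ B₃) ∎
    where
    open ≡-Reasoning
    B₁ = k C a
    B₂ = ((n ∸ i) ℕ.+ a) C k
    B₃ = (i ℕ.+ (k ∸ a)) C k
    shuffle : ∀ g N K x y z → g * (N * K * (x * y * z)) ≡ N * K * (g * x * y * z)
    shuffle = solve-∀ ℚ-ring

term≡n!k!S₁-term : ∀ {n k i a} → a ≤ i → a ≤ k → i ℕ.+ k ≤ n ℕ.+ a → term n k i a ≡ fromℕ (n !) * fromℕ (k !) * S₁-term k i (n ∸ i) a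
term≡n!k!S₁-term {n} {k} {i} {a} a≤i a≤k i+k≤n+a =
  transport (ℕₚ.m+[n∸m]≡n a≤i) (ℕₚ.m+[n∸m]≡n a≤k) a+p+q+r≡n (term-factorial-form a (i ∸ a) (k ∸ a) r)
  where
  r = (n ℕ.+ a) ∸ (i ℕ.+ k)
  transport : ∀ {p q n k i} → a ℕ.+ p ≡ i → a ℕ.+ q ≡ k → a ℕ.+ p ℕ.+ q ℕ.+ r ≡ n →
              term (a ℕ.+ p ℕ.+ q ℕ.+ r) (a ℕ.+ q) (a ℕ.+ p) a
                ≡ fromℕ ((a ℕ.+ p ℕ.+ q ℕ.+ r) !) * fromℕ ((a ℕ.+ q) !) * S₁-term (a ℕ.+ q) (a ℕ.+ p) ((a ℕ.+ p ℕ.+ q ℕ.+ r) ∸ (a ℕ.+ p)) a →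
              term n k i a ≡ fromℕ (n !) * fromℕ (k !) * S₁-term k i (n ∸ i) a
  transport refl refl refl eq = eq
  shuffle : ∀ i x r a → i ℕ.+ x ℕ.+ r ℕ.+ a ≡ i ℕ.+ (a ℕ.+ x) ℕ.+ r
  shuffle = ℕ-solve
  a+p+q+r≡n : a ℕ.+ (i ∸ a) ℕ.+ (k ∸ a) ℕ.+ r ≡ n
  a+p+q+r≡n = ℕₚ.+-cancelʳ-≡ a _ n (begin
    a ℕ.+ (i ∸ a) ℕ.+ (k ∸ a) ℕ.+ r ℕ.+ a ≡⟨ cong (λ x → x ℕ.+ (k ∸ a) ℕ.+ r ℕ.+ a) (ℕₚ.m+[n∸m]≡n a≤i) ⟩
    i ℕ.+ (k ∸ a) ℕ.+ r ℕ.+ a             ≡⟨ shuffle i (k ∸ a) r a ⟩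
    i ℕ.+ (a ℕ.+ (k ∸ a)) ℕ.+ r           ≡⟨ cong (λ x → i ℕ.+ x ℕ.+ r) (ℕₚ.m+[n∸m]≡n a≤k) ⟩
    i ℕ.+ k ℕ.+ r                         ≡⟨ ℕₚ.m+[n∸m]≡n i+k≤n+a ⟩
    n ℕ.+ a                               ∎)
    where open ≡-Reasoning

s+a<k⇒S₁-term≡0 : ∀ {k i s a} → s ℕ.+ a < k → S₁-term k i s a ≡ 0ℚ
s+a<k⇒S₁-term≡0 {k} {i} {s} {a} s+a<k =
  trans (cong (λ z → sgn a * binom k a * z * binom (i ℕ.+ (k ∸ a)) k) (binom-0 s+a<k))
        (x*y*0*z≡0 (sgn a) (binom k a) (binom (i ℕ.+ (k ∸ a)) k))
  where
  x*y*0*z≡0 : ∀ x y z → x * y * 0ℚ * z ≡ 0ℚ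
  x*y*0*z≡0 = solve-∀ ℚ-ring

i⊓k<a⇒S₁-term≡0 : ∀ {k i s a} → i ⊓ k < a → S₁-term k i s a ≡ 0ℚ
i⊓k<a⇒S₁-term≡0 {k} {i} {s} {a} i⊓k<a with a ℕₚ.≤? k
... | no a≰k = trans (cong (λ z → sgn a * z * binom (s ℕ.+ a) k * binom (i ℕ.+ (k ∸ a)) k) (binom-0 (ℕₚ.≰⇒> a≰k)))
                     (x*0*y*z≡0 (sgn a) (binom (s ℕ.+ a) k) (binom (i ℕ.+ (k ∸ a)) k))
  where
  x*0*y*z≡0 : ∀ x y z → x * 0ℚ * y * z ≡ 0ℚ
  x*0*y*z≡0 = solve-∀ ℚ-ring
... | yes a≤k = trans (cong (λ z → sgn a * binom k a * binom (s ℕ.+ a) k * z) (binom-0 i+[k∸a]<k))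
                      (x*y*z*0≡0 (sgn a) (binom k a) (binom (s ℕ.+ a) k))
  where
  x*y*z*0≡0 : ∀ x y z → x * y * z * 0ℚ ≡ 0ℚ
  x*y*z*0≡0 = solve-∀ ℚ-ring
  i<a : i < a
  i<a = ℕₚ.≰⇒> (λ a≤i → ℕₚ.<-irrefl refl (ℕₚ.<-≤-trans i⊓k<a (ℕₚ.⊓-glb a≤i a≤k)))
  i+[k∸a]<k : i ℕ.+ (k ∸ a) < k
  i+[k∸a]<k = subst (i ℕ.+ (k ∸ a) <_) (ℕₚ.m+[n∸m]≡n a≤k) (ℕₚ.+-monoˡ-< (k ∸ a) i<a)

M≡n!k!S₁ : ∀ {n} k i → i ≤ n → M n k i ≡ fromℕ (n !) * fromℕ (k !) * S₁ k i (n ∸ i)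
M≡n!k!S₁ {n} k i i≤n = begin
  M n k i                                            ≡⟨ sumℚ-cong< (suc (i ⊓ k)) summand ⟩
  sumℚ (suc (i ⊓ k)) (λ a → n!k! * S₁-term k i s a)  ≡⟨ sym (sumℚ-distribˡ (suc (i ⊓ k)) n!k! _) ⟩
  n!k! * sumℚ (suc (i ⊓ k)) (S₁-term k i s)          ≡⟨ cong (n!k! *_) (sym (sumℚ-extend _ (s≤s (ℕₚ.m⊓n≤n i k)) (λ a → i⊓k<a⇒S₁-term≡0 {s = s}))) ⟩
  n!k! * S₁ k i s                                    ∎
  where
  open ≡-Reasoning
  s = n ∸ i
  n!k! = fromℕ (n !) * fromℕ (k !)
  summand : ∀ a → a < suc (i ⊓ k) → (if (i ℕ.+ k) ≤ᵇ (n ℕ.+ a) then term n k i a else 0ℚ) ≡ n!k! * S₁-term k i s a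
  summand a a<1+i⊓k with (i ℕ.+ k) ℕₚ.≤? (n ℕ.+ a)
  ... | yes i+k≤n+a = trans (if-≤ᵇ-yes i+k≤n+a) (term≡n!k!S₁-term (ℕₚ.m≤n⊓o⇒m≤n i k a≤i⊓k) (ℕₚ.m≤n⊓o⇒m≤o i k a≤i⊓k) i+k≤n+a)
    where a≤i⊓k = ℕₚ.≤-pred a<1+i⊓k
  ... | no i+k≰n+a = trans (if-≤ᵇ-no i+k≰n+a) (sym (trans (cong (n!k! *_) (s+a<k⇒S₁-term≡0 {i = i} {s} s+a<k)) (*-zeroʳ n!k!)))
    where
    s+a<k : s ℕ.+ a < k
    s+a<k = ℕₚ.+-cancelˡ-< i _ _ (subst (_< i ℕ.+ k) (sym (trans (sym (ℕₚ.+-assoc i s a)) (cong (ℕ._+ a) (ℕₚ.m+[n∸m]≡n i≤n))))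
                                             (ℕₚ.≰⇒> i+k≰n+a))

M≡n!k!S₃ : ∀ {n} k i → i ≤ n → M n k i ≡ fromℕ (n !) * fromℕ (k !) * S₃ n k i
M≡n!k!S₃ {n} k i i≤n = trans (M≡n!k!S₁ k i i≤n) (cong (fromℕ (n !) * fromℕ (k !) *_) (trans (S₁≡S₂ k i (n ∸ i)) (sym (S₃≡S₂ k i≤n))))

S₃-difference : ∀ n k i → S₃ n k i - S₃ n k n ≡ sumℚ k (λ m → basisCoeff n k (suc m) * (binom i (suc m) - binom n (suc m)))
S₃-difference n k i = begin
  S₃ n k i - S₃ n k n
    ≡⟨ cong (S₃ n k i +_) (sumℚ-neg (suc k) _) ⟩
  S₃ n k i + sumℚ (suc k) (λ m → - (basisCoeff n k m * binom n m))
    ≡⟨ sym (sumℚ-distrib-+ (suc k) _ _) ⟩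
  sumℚ (suc k) (λ m → basisCoeff n k m * binom i m + - (basisCoeff n k m * binom n m))
    ≡⟨ sumℚ-cong (suc k) (λ m → factor (basisCoeff n k m) (binom i m) (binom n m)) ⟩
  sumℚ (suc k) (λ m → basisCoeff n k m * (binom i m - binom n m))
    ≡⟨ sumℚ-head k _ ⟩
  basisCoeff n k 0 * (1ℚ - 1ℚ) + sumℚ k (λ m → basisCoeff n k (suc m) * (binom i (suc m) - binom n (suc m)))
    ≡⟨ x*[1-1]+y≡y (basisCoeff n k 0) (sumℚ k (λ m → basisCoeff n k (suc m) * (binom i (suc m) - binom n (suc m)))) ⟩
  sumℚ k (λ m → basisCoeff n k (suc m) * (binom i (suc m) - binom n (suc m))) ∎
  where
  open ≡-Reasoning
  factor : ∀ c x y → c * x + - (c * y) ≡ c * (x - y)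
  factor = solve-∀ ℚ-ring
  x*[1-1]+y≡y : ∀ x y → x * (1ℚ - 1ℚ) + y ≡ y
  x*[1-1]+y≡y = solve-∀ ℚ-ring

sumFin-cong : ∀ n {f g : Fin n → ℚ} → f ≗ g → sumFin n f ≡ sumFin n g
sumFin-cong zero    f≗g = refl
sumFin-cong (suc n) f≗g = cong₂ _+_ (f≗g fzero) (sumFin-cong n (f≗g ∘ fsuc))

sumFin-0 : ∀ n {f : Fin n → ℚ} → (∀ x → f x ≡ 0ℚ) → sumFin n f ≡ 0ℚ
sumFin-0 zero    f≡0 = refl
sumFin-0 (suc n) f≡0 = trans (cong₂ _+_ (f≡0 fzero) (sumFin-0 n (f≡0 ∘ fsuc))) (+-identityʳ 0ℚ)

sumFin-distrib-+ : ∀ n (f g : Fin n → ℚ) → sumFin n (λ x → f x + g x) ≡ sumFin n f + sumFin n g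
sumFin-distrib-+ zero    f g = refl
sumFin-distrib-+ (suc n) f g = trans (cong (f fzero + g fzero +_) (sumFin-distrib-+ n (f ∘ fsuc) (g ∘ fsuc)))
                                     (interchange (f fzero) (g fzero) (sumFin n (f ∘ fsuc)) (sumFin n (g ∘ fsuc)))
  where
  interchange : ∀ a b c d → (a + b) + (c + d) ≡ (a + c) + (b + d)
  interchange = solve-∀ ℚ-ring

sumFin-distribˡ : ∀ n c (f : Fin n → ℚ) → c * sumFin n f ≡ sumFin n (λ x → c * f x)
sumFin-distribˡ zero    c f = *-zeroʳ c
sumFin-distribˡ (suc n) c f = trans (*-distribˡ-+ c (f fzero) _) (cong (c * f fzero +_) (sumFin-distribˡ n c (f ∘ fsuc)))

sumFin-distribʳ : ∀ n c (f : Fin n → ℚ) → sumFin n f * c ≡ sumFin n (λ x → f x * c)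
sumFin-distribʳ n c f = trans (*-comm (sumFin n f) c) (trans (sumFin-distribˡ n c f) (sumFin-cong n (λ x → *-comm c (f x))))

sumFin-neg : ∀ n (f : Fin n → ℚ) → - sumFin n f ≡ sumFin n (λ x → - f x)
sumFin-neg zero    f = refl
sumFin-neg (suc n) f = trans (neg-distrib-+ (f fzero) _) (cong (- f fzero +_) (sumFin-neg n (f ∘ fsuc)))

sumFin-comm : ∀ m p (f : Fin m → Fin p → ℚ) → sumFin m (λ a → sumFin p (f a)) ≡ sumFin p (λ b → sumFin m (λ a → f a b))
sumFin-comm zero    p f = sym (sumFin-0 p (λ _ → refl))
sumFin-comm (suc m) p f = trans (cong (sumFin p (f fzero) +_) (sumFin-comm m p (f ∘ fsuc))) (sym (sumFin-distrib-+ p _ _))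

sumFin-toℕ : ∀ n (f : ℕ → ℚ) → sumFin n (f ∘ toℕ) ≡ sumℚ n f
sumFin-toℕ zero    f = refl
sumFin-toℕ (suc n) f = trans (cong (f 0 +_) (sumFin-toℕ n (f ∘ suc))) (sym (sumℚ-head n f))

identity-suc : ∀ {n} (r c : Fin n) → identity (suc n) (fsuc r) (fsuc c) ≡ identity n r c
identity-suc r c with fsuc r ≟ᶠ fsuc c | r ≟ᶠ c
... | yes _    | yes _    = refl
... | no _     | no _     = refl
... | yes eq   | no r≢c   = ⊥-elim (r≢c (Finₚ.suc-injective eq))
... | no sr≢sc | yes refl = ⊥-elim (sr≢sc refl)

sumFin-identityˡ : ∀ n (r : Fin n) (v : Fin n → ℚ) → sumFin n (λ t → identity n r t * v t) ≡ v r
sumFin-identityˡ (suc n) fzero    v = trans (cong₂ _+_ (*-identityˡ (v fzero)) (sumFin-0 n (λ t → *-zeroˡ (v (fsuc t))))) (+-identityʳ _)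
sumFin-identityˡ (suc n) (fsuc r) v = trans (cong₂ _+_ (*-zeroˡ (v fzero)) (trans (sumFin-cong n (λ t → cong (_* v (fsuc t)) (identity-suc r t)))
                                                                               (sumFin-identityˡ n r (v ∘ fsuc))))
                                            (+-identityˡ _)

module _ {n : ℕ} where

  infix 4 _≋_
  _≋_ : Matrix n → Matrix n → Set
  A ≋ B = ∀ r c → A r c ≡ B r c

  transpose : Matrix n → Matrix n
  transpose A r c = A c r

  identity-sym : ∀ (r c : Fin n) → identity n r c ≡ identity n c r
  identity-sym r c with r ≟ᶠ c | c ≟ᶠ r
  ... | yes refl | yes _    = refl
  ... | yes refl | no c≢r   = ⊥-elim (c≢r refl)
  ... | no r≢c   | yes refl = ⊥-elim (r≢c refl)
  ... | no _     | no _     = refl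

  ⊗-congˡ : ∀ {A A′ : Matrix n} (B : Matrix n) → A ≋ A′ → (A ⊗ B) ≋ (A′ ⊗ B)
  ⊗-congˡ B A≋A′ r c = sumFin-cong n (λ t → cong (_* B t c) (A≋A′ r t))

  ⊗-congʳ : ∀ (A : Matrix n) {B B′ : Matrix n} → B ≋ B′ → (A ⊗ B) ≋ (A ⊗ B′)
  ⊗-congʳ A B≋B′ r c = sumFin-cong n (λ t → cong (A r t *_) (B≋B′ t c))

  ⊗-assoc : ∀ (X Y Z : Matrix n) → ((X ⊗ Y) ⊗ Z) ≋ (X ⊗ (Y ⊗ Z))
  ⊗-assoc X Y Z r c = begin
    sumFin n (λ t → sumFin n (λ u → X r u * Y u t) * Z t c)   ≡⟨ sumFin-cong n (λ t → sumFin-distribʳ n (Z t c) _) ⟩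
    sumFin n (λ t → sumFin n (λ u → X r u * Y u t * Z t c))   ≡⟨ sumFin-comm n n _ ⟩
    sumFin n (λ u → sumFin n (λ t → X r u * Y u t * Z t c))   ≡⟨ sumFin-cong n (λ u → trans (sumFin-cong n (λ t → *-assoc (X r u) (Y u t) (Z t c)))
                                                                                            (sym (sumFin-distribˡ n (X r u) _))) ⟩
    sumFin n (λ u → X r u * sumFin n (λ t → Y u t * Z t c))   ∎
    where open ≡-Reasoning

  ⊗-identityˡ : ∀ (A : Matrix n) → (identity n ⊗ A) ≋ A
  ⊗-identityˡ A r c = sumFin-identityˡ n r (λ t → A t c)

  Invertible-cong : ∀ {A A′ : Matrix n} → A ≋ A′ → Invertible A → Invertible A′
  Invertible-cong {A} {A′} A≋A′ (B , AB≋I , BA≋I) =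
    B , (λ r c → trans (sym (⊗-congˡ B A≋A′ r c)) (AB≋I r c)) , (λ r c → trans (sym (⊗-congʳ B A≋A′ r c)) (BA≋I r c))

  Invertible-⊗ : ∀ {X Y : Matrix n} → Invertible X → Invertible Y → Invertible (X ⊗ Y)
  Invertible-⊗ {X} {Y} (X⁻¹ , XX⁻¹≋I , X⁻¹X≋I) (Y⁻¹ , YY⁻¹≋I , Y⁻¹Y≋I) =
    Y⁻¹ ⊗ X⁻¹ , cancel X Y Y⁻¹ X⁻¹ YY⁻¹≋I XX⁻¹≋I , cancel Y⁻¹ X⁻¹ X Y X⁻¹X≋I Y⁻¹Y≋I
    where
    cancel : ∀ P Q R S → (Q ⊗ R) ≋ identity n → (P ⊗ S) ≋ identity n → ((P ⊗ Q) ⊗ (R ⊗ S)) ≋ identity n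
    cancel P Q R S QR≋I PS≋I r c = begin
      ((P ⊗ Q) ⊗ (R ⊗ S)) r c ≡⟨ ⊗-assoc P Q (R ⊗ S) r c ⟩
      (P ⊗ (Q ⊗ (R ⊗ S))) r c ≡⟨ ⊗-congʳ P (λ r′ c′ → sym (⊗-assoc Q R S r′ c′)) r c ⟩
      (P ⊗ ((Q ⊗ R) ⊗ S)) r c ≡⟨ ⊗-congʳ P (λ r′ c′ → trans (⊗-congˡ S QR≋I r′ c′) (⊗-identityˡ S r′ c′)) r c ⟩
      (P ⊗ S) r c             ≡⟨ PS≋I r c ⟩
      identity n r c          ∎
      where open ≡-Reasoning

  Invertible-transpose : ∀ {A : Matrix n} → Invertible (transpose A) → Invertible A
  Invertible-transpose {A} (B , AᵀB≋I , BAᵀ≋I) = transpose B , flip B (transpose A) BAᵀ≋I , flip (transpose A) B AᵀB≋I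
    where
    flip : ∀ X Y → (X ⊗ Y) ≋ identity n → (transpose Y ⊗ transpose X) ≋ identity n
    flip X Y XY≋I r c = trans (sumFin-cong n (λ t → *-comm (Y t r) (X c t))) (trans (XY≋I c r) (identity-sym c r))

  ⊗-assoc-vec : ∀ (X Y : Matrix n) (v : Fin n → ℚ) r →
                sumFin n (λ t → X r t * sumFin n (λ u → Y t u * v u)) ≡ sumFin n (λ u → (X ⊗ Y) r u * v u)
  ⊗-assoc-vec X Y v r = begin
    sumFin n (λ t → X r t * sumFin n (λ u → Y t u * v u))  ≡⟨ sumFin-cong n (λ t → trans (sumFin-distribˡ n (X r t) _)
                                                                                   (sumFin-cong n (λ u → sym (*-assoc (X r t) (Y t u) (v u))))) ⟩
    sumFin n (λ t → sumFin n (λ u → X r t * Y t u * v u))  ≡⟨ sumFin-comm n n _ ⟩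
    sumFin n (λ u → sumFin n (λ t → X r t * Y t u * v u))  ≡⟨ sumFin-cong n (λ u → sym (sumFin-distribʳ n (v u) _)) ⟩
    sumFin n (λ u → (X ⊗ Y) r u * v u)                     ∎
    where open ≡-Reasoning

  IsLowerTriangular : Matrix n → Set
  IsLowerTriangular A = ∀ r c → toℕ r < toℕ c → A r c ≡ 0ℚ

  IsUpperTriangular : Matrix n → Set
  IsUpperTriangular A = ∀ r c → toℕ c < toℕ r → A r c ≡ 0ℚ

  NonZeroDiagonal : Matrix n → Set
  NonZeroDiagonal A = ∀ r → A r r ≢ 0ℚ

lowerRight : ∀ {n} → Matrix (suc n) → Matrix n
lowerRight A r c = A (fsuc r) (fsuc c)

-- Block inversion of A = (a 0; v A′) by (1/a 0; -(1/a) A′⁻¹ v  A′⁻¹).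
module BlockInverse {n} (A : Matrix (suc n)) (first-row≡0 : ∀ t → A fzero (fsuc t) ≡ 0ℚ) (a≢0 : A fzero fzero ≢ 0ℚ)
                    (A′⁻¹ : Matrix n) (A′A′⁻¹≋I : (lowerRight A ⊗ A′⁻¹) ≋ identity n) (A′⁻¹A′≋I : (A′⁻¹ ⊗ lowerRight A) ≋ identity n)
                    where
  private
    a = A fzero fzero
    instance _ = ℚ.≢-nonZero a≢0
    A′ = lowerRight A
    v : Fin n → ℚ
    v r = A (fsuc r) fzero
    A′⁻¹v : Fin n → ℚ
    A′⁻¹v r = sumFin n (λ t → A′⁻¹ r t * v t)
    w : Fin n → ℚ
    w r = - (1/ a * A′⁻¹v r)

  inverse : Matrix (suc n)
  inverse fzero    fzero    = 1/ a
  inverse fzero    (fsuc c) = 0ℚ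
  inverse (fsuc r) fzero    = w r
  inverse (fsuc r) (fsuc c) = A′⁻¹ r c

  A′w≡-v/a : ∀ r → sumFin n (λ t → A′ r t * w t) ≡ - (1/ a * v r)
  A′w≡-v/a r = begin
    sumFin n (λ t → A′ r t * w t)                        ≡⟨ sumFin-cong n (λ t → x*-[y*z]≡-[y*[x*z]] (A′ r t) (1/ a) (A′⁻¹v t)) ⟩
    sumFin n (λ t → - (1/ a * (A′ r t * A′⁻¹v t)))       ≡⟨ trans (sym (sumFin-neg n _)) (cong -_ (sym (sumFin-distribˡ n (1/ a) _))) ⟩
    - (1/ a * sumFin n (λ t → A′ r t * A′⁻¹v t))         ≡⟨ cong (λ z → - (1/ a * z)) (⊗-assoc-vec A′ A′⁻¹ v r) ⟩
    - (1/ a * sumFin n (λ u → (A′ ⊗ A′⁻¹) r u * v u))    ≡⟨ cong (λ z → - (1/ a * z)) (trans (sumFin-cong n (λ u → cong (_* v u) (A′A′⁻¹≋I r u)))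
                                                                                           (sumFin-identityˡ n r v)) ⟩
    - (1/ a * v r)                                       ∎
    where
    open ≡-Reasoning
    x*-[y*z]≡-[y*[x*z]] : ∀ x y z → x * (- (y * z)) ≡ - (y * (x * z))
    x*-[y*z]≡-[y*[x*z]] = solve-∀ ℚ-ring

  A⊗inverse≋I : (A ⊗ inverse) ≋ identity (suc n)
  A⊗inverse≋I fzero    fzero    = trans (cong₂ _+_ (*-inverseʳ a) (sumFin-0 n (λ t → trans (cong (_* w t) (first-row≡0 t)) (*-zeroˡ (w t)))))
                                        (+-identityʳ 1ℚ)
  A⊗inverse≋I fzero    (fsuc c) = trans (cong₂ _+_ (*-zeroʳ a) (sumFin-0 n (λ t → trans (cong (_* A′⁻¹ t c) (first-row≡0 t)) (*-zeroˡ (A′⁻¹ t c)))))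
                                        (+-identityʳ 0ℚ)
  A⊗inverse≋I (fsuc r) fzero    = trans (cong (v r * 1/ a +_) (A′w≡-v/a r)) (x*y+-[y*x]≡0 (v r) (1/ a))
    where
    x*y+-[y*x]≡0 : ∀ x y → x * y + - (y * x) ≡ 0ℚ
    x*y+-[y*x]≡0 = solve-∀ ℚ-ring
  A⊗inverse≋I (fsuc r) (fsuc c) = trans (cong₂ _+_ (*-zeroʳ (v r)) (A′A′⁻¹≋I r c)) (trans (+-identityˡ _) (sym (identity-suc r c)))

  inverse⊗A≋I : (inverse ⊗ A) ≋ identity (suc n)
  inverse⊗A≋I fzero    fzero    = trans (cong₂ _+_ (*-inverseˡ a) (sumFin-0 n (λ t → *-zeroˡ (v t)))) (+-identityʳ 1ℚ)
  inverse⊗A≋I fzero    (fsuc c) = trans (cong₂ _+_ (trans (cong (1/ a *_) (first-row≡0 c)) (*-zeroʳ (1/ a))) (sumFin-0 n (λ t → *-zeroˡ (A′ t c))))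
                                        (+-identityʳ 0ℚ)
  inverse⊗A≋I (fsuc r) fzero    = trans (-[y*s]*z+s≡s-[y*z]*s (1/ a) (A′⁻¹v r) a)
                                        (trans (cong (λ z → A′⁻¹v r - z * A′⁻¹v r) (*-inverseˡ a)) (x-1*x≡0 (A′⁻¹v r)))
    where
    -[y*s]*z+s≡s-[y*z]*s : ∀ y s z → (- (y * s)) * z + s ≡ s - (y * z) * s
    -[y*s]*z+s≡s-[y*z]*s = solve-∀ ℚ-ring
    x-1*x≡0 : ∀ x → x - 1ℚ * x ≡ 0ℚ
    x-1*x≡0 = solve-∀ ℚ-ring
  inverse⊗A≋I (fsuc r) (fsuc c) = trans (cong₂ _+_ (trans (cong (w r *_) (first-row≡0 c)) (*-zeroʳ (w r))) (A′⁻¹A′≋I r c))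
                                        (trans (+-identityˡ _) (sym (identity-suc r c)))

lowerTriangular⇒invertible : ∀ {n} (A : Matrix n) → IsLowerTriangular A → NonZeroDiagonal A → Invertible A
lowerTriangular⇒invertible {zero}  A _ _ = (λ ()) , (λ ()) , (λ ())
lowerTriangular⇒invertible {suc n} A lower diag≢0 = inverse , A⊗inverse≋I , inverse⊗A≋I
  where
  A′-invertible = lowerTriangular⇒invertible (lowerRight A) (λ r c r<c → lower (fsuc r) (fsuc c) (s≤s r<c)) (diag≢0 ∘ fsuc)
  open BlockInverse A (λ t → lower fzero (fsuc t) (s≤s z≤n)) (diag≢0 fzero)
                      (proj₁ A′-invertible) (proj₁ (proj₂ A′-invertible)) (proj₂ (proj₂ A′-invertible))

upperTriangular⇒invertible : ∀ {n} (A : Matrix n) → IsUpperTriangular A → NonZeroDiagonal A → Invertible A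
upperTriangular⇒invertible A upper diag≢0 =
  Invertible-transpose (lowerTriangular⇒invertible (transpose A) (λ r c r<c → upper c r r<c) diag≢0)

module Factorisation (n : ℕ) where

  K : ℕ → ℚ
  K j = fromℕ (n !) * fromℕ (suc j !)

  Lℕ Pℕ Rℕ : ℕ → ℕ → ℚ
  Lℕ j m = if m ≤ᵇ j then K j * basisCoeff n (suc j) (suc m) else 0ℚ
  Pℕ m t = binom t m
  Rℕ t i = if i ≤ᵇ t then - 1ℚ else 0ℚ

  restrict : (ℕ → ℕ → ℚ) → Matrix n
  restrict f r c = f (toℕ r) (toℕ c)

  L P R : Matrix n
  L = restrict Lℕ
  P = restrict Pℕ
  R = restrict Rℕ

  P⊗R-entry : ∀ m i → i ≤ n → sumFin n (λ t → Pℕ m (toℕ t) * Rℕ (toℕ t) i) ≡ binom i (suc m) - binom n (suc m)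
  P⊗R-entry m i i≤n = begin
    sumFin n (λ t → Pℕ m (toℕ t) * Rℕ (toℕ t) i)            ≡⟨ sumFin-toℕ n (λ t → Pℕ m t * Rℕ t i) ⟩
    sumℚ n (λ t → binom t m * Rℕ t i)                       ≡⟨ sumℚ-cong n (λ t → x*[-1or0]≡-[xor0] (i ≤ᵇ t) (binom t m)) ⟩
    sumℚ n (λ t → - (if i ≤ᵇ t then binom t m else 0ℚ))     ≡⟨ sym (sumℚ-neg n _) ⟩
    - sumℚ n (λ t → if i ≤ᵇ t then binom t m else 0ℚ)       ≡⟨ cong -_ (hockey-stick m i≤n) ⟩
    - (binom n (suc m) - binom i (suc m))                   ≡⟨ -[x-y]≡y-x (binom n (suc m)) (binom i (suc m)) ⟩
    binom i (suc m) - binom n (suc m)                       ∎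
    where
    open ≡-Reasoning
    x*[-1or0]≡-[xor0] : ∀ b x → x * (if b then - 1ℚ else 0ℚ) ≡ - (if b then x else 0ℚ)
    x*[-1or0]≡-[xor0] true  x = trans (*-comm x (- 1ℚ)) (trans (sym (neg-distribˡ-* 1ℚ x)) (cong -_ (*-identityˡ x)))
    x*[-1or0]≡-[xor0] false x = *-zeroʳ x
    -[x-y]≡y-x : ∀ x y → - (x - y) ≡ y - x
    -[x-y]≡y-x = solve-∀ ℚ-ring

  M-row-expansion : ∀ j i → j < n → i ≤ n →
    M n (suc j) i - M n (suc j) n ≡ sumℚ n (λ m → Lℕ j m * (binom i (suc m) - binom n (suc m)))
  M-row-expansion j i j<n i≤n = begin
    M n k i - M n k n
      ≡⟨ cong₂ _-_ (M≡n!k!S₃ k i i≤n) (M≡n!k!S₃ k n ℕₚ.≤-refl) ⟩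
    K j * S₃ n k i - K j * S₃ n k n
      ≡⟨ x*y-x*z≡x*[y-z] (K j) (S₃ n k i) (S₃ n k n) ⟩
    K j * (S₃ n k i - S₃ n k n)
      ≡⟨ cong (K j *_) (S₃-difference n k i) ⟩
    K j * sumℚ k (λ m → basisCoeff n k (suc m) * D m)
      ≡⟨ sumℚ-distribˡ k (K j) _ ⟩
    sumℚ k (λ m → K j * (basisCoeff n k (suc m) * D m))
      ≡⟨ sumℚ-cong< k (λ m m<k → trans (sym (*-assoc (K j) _ (D m))) (cong (_* D m) (sym (if-≤ᵇ-yes (ℕₚ.≤-pred m<k))))) ⟩
    sumℚ k (λ m → Lℕ j m * D m)
      ≡⟨ sym (sumℚ-extend _ j<n (λ m j<m → trans (cong (_* D m) (if-≤ᵇ-no (ℕₚ.<⇒≱ j<m))) (*-zeroˡ (D m)))) ⟩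
    sumℚ n (λ m → Lℕ j m * D m) ∎
    where
    open ≡-Reasoning
    k = suc j
    D : ℕ → ℚ
    D m = binom i (suc m) - binom n (suc m)
    x*y-x*z≡x*[y-z] : ∀ x y z → x * y - x * z ≡ x * (y - z)
    x*y-x*z≡x*[y-z] = solve-∀ ℚ-ring

  M′≋L⊗[P⊗R] : M′ n ≋ (L ⊗ (P ⊗ R))
  M′≋L⊗[P⊗R] j i = begin
    M n (suc (toℕ j)) (toℕ i) - M n (suc (toℕ j)) n
      ≡⟨ M-row-expansion (toℕ j) (toℕ i) (Finₚ.toℕ<n j) (Finₚ.toℕ≤n i) ⟩
    sumℚ n (λ m → Lℕ (toℕ j) m * (binom (toℕ i) (suc m) - binom n (suc m)))
      ≡⟨ sumℚ-cong n (λ m → cong (Lℕ (toℕ j) m *_) (sym (P⊗R-entry m (toℕ i) (Finₚ.toℕ≤n i)))) ⟩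
    sumℚ n (λ m → Lℕ (toℕ j) m * sumFin n (λ t → Pℕ m (toℕ t) * Rℕ (toℕ t) (toℕ i)))
      ≡⟨ sym (sumFin-toℕ n _) ⟩
    (L ⊗ (P ⊗ R)) j i ∎
    where open ≡-Reasoning

  L-lower : IsLowerTriangular L
  L-lower r c r<c = if-≤ᵇ-no (ℕₚ.<⇒≱ r<c)

  L-diagonal : NonZeroDiagonal L
  L-diagonal r Lrr≡0 = Kk≢0 (trans (sym (if-≤ᵇ-yes {m = toℕ r} {y = 0ℚ} ℕₚ.≤-refl)) Lrr≡0)
    where
    k = suc (toℕ r)
    Kk≢0 : K (toℕ r) * basisCoeff n k k ≢ 0ℚ
    Kk≢0 = *-≢0 (*-≢0 (fromℕ-≢0 (n !) {{n !≢0}}) (fromℕ-≢0 (k !) {{k !≢0}}))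
                (*-≢0 (*-≢0 (sgn≢0 k) (binom-≢0 (ℕₚ.m≤n+m k k)))
                      (binom-≢0 (ℕₚ.∸-monoˡ-≤ k (Finₚ.toℕ<n r))))

  P-upper : IsUpperTriangular P
  P-upper r c c<r = binom-0 c<r

  P-diagonal : NonZeroDiagonal P
  P-diagonal r = binom-≢0 (ℕₚ.≤-refl {toℕ r})

  R-lower : IsLowerTriangular R
  R-lower r c r<c = if-≤ᵇ-no (ℕₚ.<⇒≱ r<c)

  R-diagonal : NonZeroDiagonal R
  R-diagonal r Rrr≡0 with trans (sym (if-≤ᵇ-yes {m = toℕ r} {y = 0ℚ} ℕₚ.≤-refl)) Rrr≡0
  ... | ()

mainTheorem3 : (n : ℕ) → n ≥ 1 → Invertible (M′ n)
mainTheorem3 n _ = Invertible-cong (λ j i → sym (M′≋L⊗[P⊗R] j i))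
  (Invertible-⊗ (lowerTriangular⇒invertible L L-lower L-diagonal)
    (Invertible-⊗ (upperTriangular⇒invertible P P-upper P-diagonal)
                  (lowerTriangular⇒invertible R R-lower R-diagonal)))
  where open Factorisation n
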